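{- In the theory $\mathcal{Q}\#$: for every $m$-atom $x$, $qc([x])=_E 1$.
   Context: Quasi-set theory $\mathcal{Q}$ is a first-order theory in classical logic with no primitive equality symbol. Primitive symbols: unary predicates $m$ ("$x$ is an $m$-atom"), $M$ ("$x$ is an $M$-atom"), $Z$ ("$x$ is a set"); binary predicates $\equiv$ (indistinguishability) and $\in$; a unary function symbol $qc$ (quasi-cardinal). Abbreviations: $Q(x):=\neg(m(x)\vee M(x))$ ("$x$ is a qset"); $D(x):=M(x)\vee Z(x)$; $E(x):=Q(x)\wedge\forall y(y\in x\Rightarrow Q(y))$; $x=_E y:=(Q(x)\wedge Q(y)\wedge\forall z(z\in x\Leftrightarrow z\in y))\vee(M(x)\wedge M(y)\wedge\forall z(Q(z)\Rightarrow(x\in z\Leftrightarrow y\in z)))$ (extensional identity), $x\neq_E y:=\neg(x=_E y)$; $x\subseteq y:=\forall z(z\in x\Rightarrow z\in y)$; $x\subset y:=x\subseteq y\wedge x\neq_E y$; $\forall_Q,\exists_Q,\forall_D$ are quantifiers relativized to $Q$, $D$. Axioms of $\mathcal{Q}$: (Q1)–(Q3) $\equiv$ is reflexive, symmetric and transitive. (Q4) $\forall x\forall y(x=_E y\Rightarrow(A(x,x)\Rightarrow A(x,y)))$ for every formula $A$, with $A(x,y)$ obtained by replacing some free occurrences of $x$ by $y$, $y$ free for $x$. (Q5) $\forall x\,\neg(m(x)\wedge M(x))$. (Q6) $\forall x\forall y(x\in y\Rightarrow Q(y))$. (Q7) $\forall x(Z(x)\Rightarrow Q(x))$. (Q8)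 $\forall_Q x(\forall y(y\in x\Rightarrow D(y))\Leftrightarrow Z(x))$. (Q9) $\forall x\forall y(m(x)\wedge x\equiv y\Rightarrow m(y))$, $\forall x\forall y(x=_E y\wedge M(x)\Rightarrow M(y))$, $\forall x\forall y(x=_E y\wedge Z(x)\Rightarrow Z(y))$. (Q10) $\exists_Q x\forall y\,\neg(y\in x)$; such a qset is written $\emptyset$. (Q11) $\forall_D x\forall_D y(x\equiv y\Rightarrow x=_E y)$. (Q12) $\forall x\forall y\exists_Q z\forall t(t\in z\Leftrightarrow t\equiv x\vee t\equiv y)$; this qset is written $[x,y]$, and $[x]:=[x,x]$. (Q13) Separation: for each formula $A(t)$ without $y$ free, $\forall_Q x\exists_Q y\forall t(t\in y\Leftrightarrow t\in x\wedge A(t))$; written $[t\in x:A(t)]$. (Q14) $\forall_Q x(E(x)\Rightarrow\exists_Q y\forall z(z\in y\Leftrightarrow\exists t(z\in t\wedge t\in x)))$; written $\bigcup_{t\in x}t$. For qsets $x,y$, $x\cup y$, $x\cap y$, $x-y$ denote the qsets whose elements are exactly the objects in $x$ or in $y$, in both, in $x$ but not in $y$, respectively. (Q15) $\forall_Q x\exists_Q y\forall t(t\in y\Leftrightarrow t\subseteq x)$; written $\mathcal{P}(x)$. Also $\langle x,y\rangle:=[[x],[x,y]]$. (Q16) $\exists_Q x(\emptyset\in x\wedge\forall y(y\in x\wedge Q(y)\Rightarrow y\cup[y]\in x))$. (Q17) $\forall_Q x(E(x)\wedge x\neq_E\emptyset\Rightarrow\exists_Q y(y\in x\wedge y\cap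 x=_E\emptyset))$. The objects satisfying $D$ (with $\in$ and $=_E$) form a copy of ZFU set theory inside $\mathcal{Q}$; in it cardinals, natural numbers ($0,1,\dots$), cardinal arithmetic ($+,\le,<,2^\kappa$) and the cardinal $card(x)$ of a set are defined as usual; $Fin(x)$ means $qc(x)$ is a natural number. (Q18) $\forall x(\neg Q(x)\Rightarrow qc(x)=_E 0)$. (Q19) for every qset $x$, $qc(x)$ is a cardinal, and if $Z(x)$ then $qc(x)=_E card(x)$. (Q20) $\forall_Q x(x\neq_E\emptyset\Rightarrow qc(x)\neq_E 0)$. (Q21) for every qset $x$ and cardinal $\beta\le qc(x)$ there is a qset $y\subseteq x$ with $qc(y)=_E\beta$. (Q22) for qsets $y\subseteq x$, $qc(y)\le qc(x)$. (Q23) for qsets, $Fin(x)\wedge x\subset y\Rightarrow qc(x)<qc(y)$. (Q24) for qsets $x,y$ with no common element, $qc(x\cup y)=_E qc(x)+qc(y)$. (Q25) $\forall_Q x(qc(\mathcal{P}(x))=_E 2^{qc(x)})$. For nonempty qsets: $Sim(x,y):=\forall z\forall t(z\in x\wedge t\in y\Rightarrow z\equiv t)$, $QSim(x,y):=Sim(x,y)\wedge qc(x)=_E qc(y)$; $x/{\equiv}$ denotes the qset of the classes $[t\in x: t\equiv s]$ for $s\in x$. (Q26) Weak extensionality: $\forall_Q x\forall_Q y\big((\forall z(z\in x/{\equiv}\Rightarrow\exists t(t\in y/{\equiv}\wedge QSim(z,t)))\wedge\forall t(t\in y/{\equiv}\Rightarrow\exists z(z\in x/{\equiv}\wedge QSim(t,z))))\Rightarrow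 x\equiv y\big)$. (Q27) Replacement: for each formula $A(x,y)$, if $\forall x\exists y A(x,y)\wedge\forall x\forall x'\forall y\forall y'(A(x,y)\wedge A(x',y')\wedge x\equiv x'\Rightarrow y\equiv y')$, then $\forall_Q u\exists_Q v\forall z(z\in v\Rightarrow\exists w(w\in u\wedge A(w,z)))$. (Q28) Choice: $\forall_Q x\big(E(x)\wedge\forall y\forall z(y\in x\wedge z\in x\Rightarrow y\cap z=_E\emptyset\wedge y\neq_E\emptyset)\Rightarrow\exists_Q u\forall y\forall v(y\in x\wedge v\in y\Rightarrow\exists_Q w(w\subseteq[v]\wedge qc(w)=_E1\wedge w\cap y\equiv w\cap u))\big)$. The theory $\mathcal{Q}\#$ is $\mathcal{Q}$ with axiom (Q4) replaced by (Q4#): $\forall x\forall y(\neg m(x)\wedge\neg m(y)\wedge x\equiv y\Rightarrow(A(x,x)\Rightarrow A(x,y)))$, for every formula $A$ with the same substitution conventions as in (Q4). -}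

module Defs where

-- Semantic rendering of the first-order theory Q# :
-- a structure for the language {m, M, Z, ≡, ∈, qc}, a syntax of
-- first-order formulas (needed for the axiom schemes Q4#, Q13, Q27),
-- and the axioms (Q1)-(Q3), (Q4#), (Q5)-(Q28) as a record of fields.

open import Data.Nat using (ℕ; zero; suc)
open import Data.Product using (Σ; ∃; ∃₂; _×_; _,_)
open import Data.Sum using (_⊎_)
open import Data.Empty using (⊥)
open import Relation.Nullary using (¬_)

infix 2 _↔_
_↔_ : Set → Set → Set
A ↔ B = (A → B) × (B → A)

record Structure : Set₁ where
  field
    Carrier : Set
    m M Z   : Carrier → Set
    _≡_     : Carrier → Carrier → Set
    _∈_     : Carrier → Carrier → Set
    qc      : Carrier → Carrier

-- First-order syntax (de Bruijn variables; no primitive equality)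

data Term : Set where
  var : ℕ → Term
  qcₜ : Term → Term

data Formula : Set where
  mᶠ Mᶠ Zᶠ   : Term → Formula
  _≡ᶠ_ _∈ᶠ_  : Term → Term → Formula
  ⊥ᶠ         : Formula
  ¬ᶠ_        : Formula → Formula
  _∧ᶠ_ _∨ᶠ_ _⇒ᶠ_ : Formula → Formula → Formula
  ∀ᶠ ∃ᶠ      : Formula → Formula

module Notions (S : Structure) where
  open Structure S

  Env : Set
  Env = ℕ → Carrier

  _∷ₑ_ : Carrier → Env → Env
  (d ∷ₑ ρ) zero    = d
  (d ∷ₑ ρ) (suc n) = ρ n

  eval : Env → Term → Carrier
  eval ρ (var n)  = ρ n
  eval ρ (qcₜ t)  = qc (eval ρ t)

  Sat : Formula → Env → Set
  Sat (mᶠ t) ρ     = m (eval ρ t)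
  Sat (Mᶠ t) ρ     = M (eval ρ t)
  Sat (Zᶠ t) ρ     = Z (eval ρ t)
  Sat (s ≡ᶠ t) ρ   = eval ρ s ≡ eval ρ t
  Sat (s ∈ᶠ t) ρ   = eval ρ s ∈ eval ρ t
  Sat ⊥ᶠ ρ         = ⊥
  Sat (¬ᶠ φ) ρ     = ¬ Sat φ ρ
  Sat (φ ∧ᶠ ψ) ρ   = Sat φ ρ × Sat ψ ρ
  Sat (φ ∨ᶠ ψ) ρ   = Sat φ ρ ⊎ Sat ψ ρ
  Sat (φ ⇒ᶠ ψ) ρ   = Sat φ ρ → Sat ψ ρ
  Sat (∀ᶠ φ) ρ     = ∀ d → Sat φ (d ∷ₑ ρ)
  Sat (∃ᶠ φ) ρ     = ∃ λ d → Sat φ (d ∷ₑ ρ)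

  Q : Carrier → Set
  Q x = ¬ (m x ⊎ M x)

  D : Carrier → Set
  D x = M x ⊎ Z x

  E : Carrier → Set
  E x = Q x × (∀ y → y ∈ x → Q y)

  _=E_ : Carrier → Carrier → Set
  x =E y = (Q x × Q y × (∀ z → (z ∈ x ↔ z ∈ y)))
         ⊎ (M x × M y × (∀ z → Q z → (x ∈ z ↔ y ∈ z)))

  _⊆_ : Carrier → Carrier → Set
  x ⊆ y = ∀ z → z ∈ x → z ∈ y

  _⊂_ : Carrier → Carrier → Set
  x ⊂ y = x ⊆ y × ¬ (x =E y)

  IsEmpty : Carrier → Set
  IsEmpty e = Q e × (∀ y → ¬ (y ∈ e))

  IsPairQ : Carrier → Carrier → Carrier → Set
  IsPairQ x y z = Q z × (∀ t → (t ∈ z ↔ (t ≡ x ⊎ t ≡ y)))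

  IsSingQ : Carrier → Carrier → Set
  IsSingQ x z = IsPairQ x x z

  IsUnion : Carrier → Carrier → Carrier → Set
  IsUnion x y z = Q z × (∀ t → (t ∈ z ↔ (t ∈ x ⊎ t ∈ y)))

  IsInter : Carrier → Carrier → Carrier → Set
  IsInter x y z = Q z × (∀ t → (t ∈ z ↔ (t ∈ x × t ∈ y)))

  IsBigUnion : Carrier → Carrier → Set
  IsBigUnion x z = Q z × (∀ t → (t ∈ z ↔ (∃ λ u → t ∈ u × u ∈ x)))

  IsPow : Carrier → Carrier → Set
  IsPow x p = Q p × (∀ t → (t ∈ p ↔ (Q t × t ⊆ x)))

  IsSuccQ : Carrier → Carrier → Set
  IsSuccQ y z = Q z × (∀ t → (t ∈ z ↔ (t ∈ y ⊎ t ≡ y)))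

  IsOPair : Carrier → Carrier → Carrier → Set
  IsOPair a b p = ∃₂ λ s₁ s₂ → IsSingQ a s₁ × IsPairQ a b s₂ × IsPairQ s₁ s₂ p

  -- The usual ZFU notions, in the D-part (sets = Z, equality = =E)

  Transitive : Carrier → Set
  Transitive α = ∀ y → y ∈ α → y ⊆ α

  IsOrdinal : Carrier → Set
  IsOrdinal α = Z α × Transitive α × (∀ y → y ∈ α → Z y)
              × (∀ y z → y ∈ α → z ∈ α → (y ∈ z ⊎ y =E z ⊎ z ∈ y))
              × (∀ s → Q s → s ⊆ α → (∃ λ y → y ∈ s)
                   → ∃ λ y → y ∈ s × (∀ z → z ∈ s → ¬ (z ∈ y)))

  IsBij : Carrier → Carrier → Carrier → Set
  IsBij x y f = Q f
    × (∀ p → p ∈ f → ∃₂ λ a b → a ∈ x × b ∈ y × IsOPair a b p)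
    × (∀ a → a ∈ x → ∃₂ λ b p → b ∈ y × IsOPair a b p × p ∈ f)
    × (∀ a b b′ p p′ → IsOPair a b p → p ∈ f → IsOPair a b′ p′ → p′ ∈ f → b =E b′)
    × (∀ a a′ b p p′ → IsOPair a b p → p ∈ f → IsOPair a′ b p′ → p′ ∈ f → a =E a′)
    × (∀ b → b ∈ y → ∃₂ λ a p → a ∈ x × IsOPair a b p × p ∈ f)

  Equinum : Carrier → Carrier → Set
  Equinum x y = ∃ λ f → IsBij x y f

  IsCardinal : Carrier → Set
  IsCardinal κ = IsOrdinal κ × (∀ β → β ∈ κ → ¬ Equinum β κ)

  IsCardOf : Carrier → Carrier → Set
  IsCardOf x κ = IsCardinal κ × Equinum x κ

  IsSuccE : Carrier → Carrier → Set
  IsSuccE β o = Q o × (∀ t → (t ∈ o ↔ (t ∈ β ⊎ t =E β)))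

  IsNat : Carrier → Set
  IsNat n = IsOrdinal n
          × (∀ β → (β ∈ n ⊎ β =E n) → (IsEmpty β ⊎ (∃ λ γ → IsSuccE γ β)))

  IsOne : Carrier → Set
  IsOne o = Q o × (∀ t → (t ∈ o ↔ IsEmpty t))

  _=E0 : Carrier → Set
  x =E0 = ∀ e → IsEmpty e → x =E e

  _=E1 : Carrier → Set
  x =E1 = ∀ o → IsOne o → x =E o

  -- cardinal order (von Neumann cardinals)
  _≤c_ : Carrier → Carrier → Set
  κ ≤c λ′ = κ ⊆ λ′

  _<c_ : Carrier → Carrier → Set
  κ <c λ′ = κ ∈ λ′

  IsCardSum : Carrier → Carrier → Carrier → Set
  IsCardSum κ λ′ μ = IsCardinal μ × (∃ λ a → ∃ λ b → ∃ λ c →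
      Z a × Z b × (∀ t → t ∈ a → ¬ (t ∈ b)) × Equinum a κ × Equinum b λ′
      × IsUnion a b c × Equinum c μ)

  IsCardPow : Carrier → Carrier → Set
  IsCardPow κ μ = IsCardinal μ × (∃ λ p → IsPow κ p × Equinum p μ)

  Fin : Carrier → Set
  Fin x = IsNat (qc x)

  Sim : Carrier → Carrier → Set
  Sim x y = ∀ z t → z ∈ x → t ∈ y → z ≡ t

  QSim : Carrier → Carrier → Set
  QSim x y = Sim x y × (qc x =E qc y)

  IsClass : Carrier → Carrier → Set
  IsClass x c = ∃ λ s → s ∈ x × Q c × (∀ t → (t ∈ c ↔ (t ∈ x × t ≡ s)))

record IsQsharpModel (S : Structure) : Set where
  open Structure S
  open Notions S
  field
    Q1  : ∀ x → x ≡ x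
    Q2  : ∀ x y → x ≡ y → y ≡ x
    Q3  : ∀ x y z → x ≡ y → y ≡ z → x ≡ z
    -- (Q4#): φ with variable 0 = the replaced occurrences, variable 1 = x
    Q4# : ∀ (φ : Formula) (ρ : Env) x y → ¬ m x → ¬ m y → x ≡ y
            → Sat φ (x ∷ₑ (x ∷ₑ ρ)) → Sat φ (y ∷ₑ (x ∷ₑ ρ))
    Q5  : ∀ x → ¬ (m x × M x)
    Q6  : ∀ x y → x ∈ y → Q y
    Q7  : ∀ x → Z x → Q x
    Q8  : ∀ x → Q x → ((∀ y → y ∈ x → D y) ↔ Z x)
    Q9a : ∀ x y → m x → x ≡ y → m y
    Q9b : ∀ x y → x =E y → M x → M y
    Q9c : ∀ x y → x =E y → Z x → Z y
    Q10 : ∃ λ x → Q x × (∀ y → ¬ (y ∈ x))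
    Q11 : ∀ x y → D x → D y → x ≡ y → x =E y
    Q12 : ∀ x y → ∃ λ z → IsPairQ x y z
    -- (Q13): φ with variable 0 = t, other variables = parameters
    Q13 : ∀ (φ : Formula) (ρ : Env) x → Q x
            → ∃ λ y → Q y × (∀ t → (t ∈ y ↔ (t ∈ x × Sat φ (t ∷ₑ ρ))))
    Q14 : ∀ x → E x → ∃ λ y → IsBigUnion x y
    Q15 : ∀ x → Q x → ∃ λ y → IsPow x y
    Q16 : ∃ λ x → Q x × (∃ λ e → IsEmpty e × e ∈ x)
            × (∀ y → y ∈ x → Q y → ∃ λ s → IsSuccQ y s × s ∈ x)
    Q17 : ∀ x → E x → ¬ (x =E0)
            → ∃ λ y → y ∈ x × (∃ λ i → IsInter y x i × IsEmpty i)
    Q18 : ∀ x → ¬ Q x → qc x =E0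
    Q19 : ∀ x → Q x → IsCardinal (qc x) × (Z x → IsCardOf x (qc x))
    Q20 : ∀ x → Q x → ¬ (x =E0) → ¬ (qc x =E0)
    Q21 : ∀ x β → Q x → IsCardinal β → β ≤c qc x
            → ∃ λ y → Q y × y ⊆ x × qc y =E β
    Q22 : ∀ x y → Q x → Q y → y ⊆ x → qc y ≤c qc x
    Q23 : ∀ x y → Q x → Q y → Fin x → x ⊂ y → qc x <c qc y
    Q24 : ∀ x y u → Q x → Q y → (∀ t → t ∈ x → ¬ (t ∈ y)) → IsUnion x y u
            → IsCardSum (qc x) (qc y) (qc u)
    Q25 : ∀ x p → Q x → IsPow x p → IsCardPow (qc x) (qc p)
    Q26 : ∀ x y → Q x → Q y
            → (∀ c → IsClass x c → ∃ λ d → IsClass y d × QSim c d)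
            → (∀ d → IsClass y d → ∃ λ c → IsClass x c × QSim d c)
            → x ≡ y
    -- (Q27): φ with variable 0 = x, variable 1 = y, others = parameters
    Q27 : ∀ (φ : Formula) (ρ : Env)
            → (∀ x → ∃ λ y → Sat φ (x ∷ₑ (y ∷ₑ ρ)))
            → (∀ x x′ y y′ → Sat φ (x ∷ₑ (y ∷ₑ ρ)) → Sat φ (x′ ∷ₑ (y′ ∷ₑ ρ))
                 → x ≡ x′ → y ≡ y′)
            → ∀ u → Q u → ∃ λ v → Q v × (∀ z → z ∈ v → ∃ λ w → w ∈ u × Sat φ (w ∷ₑ (z ∷ₑ ρ)))
    Q28 : ∀ x → E x
            → (∀ y z → y ∈ x → z ∈ x
                 → (∃ λ i → IsInter y z i × IsEmpty i) × ¬ (y =E0))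
            → ∃ λ u → Q u × (∀ y v → y ∈ x → v ∈ y
                 → ∃ λ w → Q w × (∃ λ s → IsSingQ v s × w ⊆ s) × (qc w =E1)
                     × (∃₂ λ i j → IsInter w y i × IsInter w u j × i ≡ j))

module Submission where

-- Under (Q4#) indistinguishable qsets are interchangeable as containers, and
-- weak extensionality (Q26) makes any two nonempty qsets of pairwise
-- indistinguishable objects with the same quasi-cardinal indistinguishable.
-- So if s is such a qset and y ⊆ s has quasi-cardinal 1 (Q21), every y′ ⊆ s − y
-- with quasi-cardinal 1 would be indistinguishable from y, hence contained in
-- y; thus s − y is empty and qc(s) = qc(y) = 1. Nothing about m-atoms is used.

open import Defs
open import Level using (0ℓ)
open import Axiom.ExcludedMiddle using (ExcludedMiddle)
open import Axiom.DoubleNegationElimination using (em⇒dne)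
open import Function using (_∘_)
open import Data.Product using (∃; _×_; _,_; proj₁; proj₂)
open import Data.Sum using (inj₁; inj₂)
open import Data.Empty using (⊥-elim)
open import Relation.Nullary using (¬_)

module QsharpModel (em : ExcludedMiddle 0ℓ) (S : Structure) (ax : IsQsharpModel S) where
  open Structure S
  open Notions S
  open IsQsharpModel ax

  dne : {P : Set} → ¬ ¬ P → P
  dne = em⇒dne em

  Q⇒¬m : ∀ {a} → Q a → ¬ m a
  Q⇒¬m qa = qa ∘ inj₁

  =E⇒∈↔ : ∀ {a b} → Q a → a =E b → ∀ z → (z ∈ a ↔ z ∈ b)
  =E⇒∈↔ qa (inj₁ (_ , _ , a≐b)) = a≐b
  =E⇒∈↔ qa (inj₂ (Ma , _))      = ⊥-elim (qa (inj₂ Ma))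

  =E-sym : ∀ {a b} → a =E b → b =E a
  =E-sym (inj₁ (qa , qb , f)) = inj₁ (qb , qa , λ z → proj₂ (f z) , proj₁ (f z))
  =E-sym (inj₂ (Ma , Mb , f)) = inj₂ (Mb , Ma , λ z qz → proj₂ (f z qz) , proj₁ (f z qz))

  =E-trans : ∀ {a b c} → a =E b → b =E c → a =E c
  =E-trans (inj₁ (qa , _ , f)) (inj₁ (_ , qc′ , g)) =
    inj₁ (qa , qc′ , λ z → proj₁ (g z) ∘ proj₁ (f z) , proj₂ (f z) ∘ proj₂ (g z))
  =E-trans (inj₂ (Ma , _ , f)) (inj₂ (_ , Mc , g)) =
    inj₂ (Ma , Mc , λ z qz → proj₁ (g z qz) ∘ proj₁ (f z qz) , proj₂ (f z qz) ∘ proj₂ (g z qz))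
  =E-trans (inj₁ (_ , qb , _)) (inj₂ (Mb , _))     = ⊥-elim (qb (inj₂ Mb))
  =E-trans (inj₂ (_ , Mb , _)) (inj₁ (qb , _))     = ⊥-elim (qb (inj₂ Mb))

  ∈-respˡ-≡ : ∀ {a b} κ → ¬ m a → ¬ m b → a ≡ b → a ∈ κ → b ∈ κ
  ∈-respˡ-≡ κ ¬ma ¬mb = Q4# (var 0 ∈ᶠ var 2) (λ _ → κ) _ _ ¬ma ¬mb

  ∈-respʳ-≡ : ∀ {a b} u → ¬ m a → ¬ m b → a ≡ b → u ∈ a → u ∈ b
  ∈-respʳ-≡ u ¬ma ¬mb = Q4# (var 2 ∈ᶠ var 0) (λ _ → u) _ _ ¬ma ¬mb

  IsEmpty⇒Z : ∀ {e} → IsEmpty e → Z e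
  IsEmpty⇒Z (qe , ∉e) = proj₁ (Q8 _ qe) (λ y y∈e → ⊥-elim (∉e y y∈e))

  IsEmpty-≡ : ∀ {e e′} → IsEmpty e → IsEmpty e′ → e ≡ e′
  IsEmpty-≡ (qe , ∉e) (qe′ , ∉e′) =
    Q26 _ _ qe qe′ (λ _ (_ , s∈e , _) → ⊥-elim (∉e _ s∈e))
                   (λ _ (_ , s∈e′ , _) → ⊥-elim (∉e′ _ s∈e′))

  nonempty⇒≢0 : ∀ {a z} → Q a → z ∈ a → ¬ (a =E0)
  nonempty⇒≢0 {z = z} qa z∈a a=0 with Q10
  ... | e , empty-e = proj₂ empty-e z (proj₁ (=E⇒∈↔ qa (a=0 e empty-e) z) z∈a)

  ≢0⇒nonempty : ∀ {a} → Q a → ¬ (a =E0) → ∃ (_∈ a)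
  ≢0⇒nonempty qa a≢0 = dne λ no-elem → a≢0 λ e (qe , ∉e) →
    inj₁ (qa , qe , λ z → ⊥-elim ∘ no-elem ∘ (z ,_) , ⊥-elim ∘ ∉e z)

  IsOne⇒IsCardinal : ∀ {o} → IsOne o → IsCardinal o
  IsOne⇒IsCardinal {o} (qo , o-spec) =
    ( (Zo , (λ y y∈o z z∈y → ⊥-elim (∉∈o y∈o z z∈y))
          , (λ y → IsEmpty⇒Z ∘ ∈o y)
          , (λ y z y∈o z∈o → inj₂ (inj₁ (inj₁ (proj₁ (∈o y y∈o) , proj₁ (∈o z z∈o)
               , λ w → ⊥-elim ∘ ∉∈o y∈o w , ⊥-elim ∘ ∉∈o z∈o w))))
          , (λ s _ s⊆o (y , y∈s) → y , y∈s , λ z _ → ∉∈o (s⊆o y y∈s) z))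
    , β≉o )
    where
      ∈o : ∀ y → y ∈ o → IsEmpty y
      ∈o y = proj₁ (o-spec y)
      ∉∈o : ∀ {y} → y ∈ o → ∀ z → ¬ (z ∈ y)
      ∉∈o y∈o = proj₂ (∈o _ y∈o)
      Zo : Z o
      Zo = proj₁ (Q8 o qo) (λ y → inj₂ ∘ IsEmpty⇒Z ∘ ∈o y)
      -- the empty set in o would need a preimage in the empty β
      β≉o : ∀ β → β ∈ o → ¬ Equinum β o
      β≉o β β∈o (f , _ , _ , _ , _ , _ , onto) with Q10
      ... | e , empty-e with onto e (proj₂ (o-spec e) empty-e)
      ... | a , _ , a∈β , _ = ∉∈o β∈o a a∈β

  IsOrdinal-∅∈ : ∀ {κ} → IsOrdinal κ → ∃ (_∈ κ) → ∃ λ y → y ∈ κ × IsEmpty y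
  IsOrdinal-∅∈ {κ} (Zκ , trans , elZ , _ , wf) inhabited
    with wf κ (Q7 _ Zκ) (λ _ h → h) inhabited
  ... | y , y∈κ , minimal =
    y , y∈κ , Q7 _ (elZ y y∈κ) , λ w w∈y → minimal w (trans y y∈κ w w∈y) w∈y

  qc-Q : ∀ {a} → Q a → Q (qc a)
  qc-Q {a} qa = Q7 _ (proj₁ (proj₁ (proj₁ (Q19 a qa))))

  IsOne⇒≤c-qc : ∀ {a z o} → Q a → z ∈ a → IsOne o → o ≤c qc a
  IsOne⇒≤c-qc {a} qa z∈a (_ , o-spec) t t∈o
    with proj₁ (Q19 a qa)
  ... | (ord , _) with ≢0⇒nonempty (qc-Q qa) (Q20 a qa (nonempty⇒≢0 qa z∈a))
  ... | inhabited with IsOrdinal-∅∈ ord inhabited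
  ... | y , y∈qc , empty-y =
    ∈-respˡ-≡ (qc a) (Q⇒¬m (proj₁ empty-y)) (Q⇒¬m (proj₁ empty-t))
              (IsEmpty-≡ empty-y empty-t) y∈qc
    where
      empty-t : IsEmpty t
      empty-t = proj₁ (o-spec t) t∈o

  ∃-⊆-with-qc≡1 : ∀ {a z o} → IsOne o → Q a → z ∈ a → ∃ λ y → Q y × y ⊆ a × qc y =E o
  ∃-⊆-with-qc≡1 {a} {o = o} io qa z∈a =
    Q21 a o qa (IsOne⇒IsCardinal io) (IsOne⇒≤c-qc qa z∈a io)

  qc≡1⇒nonempty : ∀ {y o} → IsOne o → Q y → qc y =E o → ∃ (_∈ y)
  qc≡1⇒nonempty {y} (_ , o-spec) qy qc≡o = dne λ no-elem →
    let Zy = proj₁ (Q8 y qy) (λ z z∈y → ⊥-elim (no-elem (z , z∈y)))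
    in no-preimage no-elem (proj₂ (proj₂ (Q19 y qy) Zy))
    where
      no-preimage : ¬ ∃ (_∈ y) → ¬ Equinum y (qc y)
      no-preimage no-elem (f , _ , _ , _ , _ , _ , onto) with Q10
      ... | e , empty-e
        with onto e (proj₂ (=E⇒∈↔ (qc-Q qy) qc≡o e) (proj₂ (o-spec e) empty-e))
      ... | a , _ , a∈y , _ = no-elem (a , a∈y)

  qc-cong : ∀ {a b} → Q a → Q b → a ⊆ b → b ⊆ a → qc a =E qc b
  qc-cong {a} {b} qa qb a⊆b b⊆a =
    inj₁ (qc-Q qa , qc-Q qb , λ z → Q22 b a qb qa a⊆b z , Q22 a b qa qb b⊆a z)

  Sim-sym : ∀ {a b} → Sim a b → Sim b a
  Sim-sym sim z t z∈b t∈a = Q2 _ _ (sim t z t∈a z∈b)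

  Sim-mono : ∀ {a b s t} → a ⊆ s → b ⊆ t → Sim s t → Sim a b
  Sim-mono a⊆s b⊆t sim z t z∈a t∈b = sim z t (a⊆s z z∈a) (b⊆t t t∈b)

  Sim⇒Sim-selfˡ : ∀ {a b w} → w ∈ b → Sim a b → Sim a a
  Sim⇒Sim-selfˡ w∈b sim z t z∈a t∈a = Q3 _ _ _ (sim z _ z∈a w∈b) (Q2 _ _ (sim t _ t∈a w∈b))

  QSim-sym : ∀ {a b} → QSim a b → QSim b a
  QSim-sym (sim , qc≡) = Sim-sym sim , =E-sym qc≡

  -- a homogeneous y₂ is its own unique class, matched by every class of y₁
  QSim-class-match : ∀ {y₁ y₂ w} → Q y₁ → Q y₂ → w ∈ y₂ → QSim y₁ y₂
    → ∀ c → IsClass y₁ c → ∃ λ d → IsClass y₂ d × QSim c d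
  QSim-class-match {y₁} {y₂} {w} q₁ q₂ w∈y₂ (sim , qc≡) c (r , r∈y₁ , qC , c-spec) =
    y₂ , (w , w∈y₂ , q₂ , λ t → (λ t∈y₂ → t∈y₂ , sim₂₂ t w t∈y₂ w∈y₂) , proj₁)
       , Sim-mono c⊆y₁ (λ _ h → h) sim , =E-trans (qc-cong qC q₁ c⊆y₁ y₁⊆c) qc≡
    where
      sim₂₂ : Sim y₂ y₂
      sim₂₂ = Sim⇒Sim-selfˡ r∈y₁ (Sim-sym sim)
      c⊆y₁ : c ⊆ y₁
      c⊆y₁ t = proj₁ ∘ proj₁ (c-spec t)
      y₁⊆c : y₁ ⊆ c
      y₁⊆c t t∈y₁ = proj₂ (c-spec t) (t∈y₁ , Sim⇒Sim-selfˡ w∈y₂ sim t r t∈y₁ r∈y₁)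

  QSim⇒≡ : ∀ {y₁ y₂ z₁ z₂} → Q y₁ → Q y₂ → z₁ ∈ y₁ → z₂ ∈ y₂ → QSim y₁ y₂ → y₁ ≡ y₂
  QSim⇒≡ q₁ q₂ z₁∈y₁ z₂∈y₂ qsim =
    Q26 _ _ q₁ q₂ (QSim-class-match q₁ q₂ z₂∈y₂ qsim)
                  (QSim-class-match q₂ q₁ z₁∈y₁ (QSim-sym qsim))

  ∃-difference : ∀ {s} → Q s → ∀ y → ∃ λ c → Q c × (∀ u → (u ∈ c ↔ (u ∈ s × ¬ (u ∈ y))))
  ∃-difference {s} qs y = Q13 (¬ᶠ (var 0 ∈ᶠ var 1)) (λ _ → y) s qs

  qc-homogeneous≡1 : ∀ {s x} → Q s → Sim s s → x ∈ s → qc s =E1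
  qc-homogeneous≡1 {s} qs sim x∈s o io with ∃-⊆-with-qc≡1 io qs x∈s
  ... | y , qy , y⊆s , qcy≡o = =E-trans (qc-cong qs qy s⊆y y⊆s) qcy≡o
    where
      s⊆y : s ⊆ y
      s⊆y t t∈s = dne λ t∉y →
        let (c , qC , c-spec) = ∃-difference qs y
            c⊆s = λ v → proj₁ ∘ proj₁ (c-spec v)
            (y′ , qy′ , y′⊆c , qcy′≡o) = ∃-⊆-with-qc≡1 io qC (proj₂ (c-spec t) (t∈s , t∉y))
            y′⊆s = λ v → c⊆s v ∘ y′⊆c v
            (u , u∈y′) = qc≡1⇒nonempty io qy′ qcy′≡o
            (_ , z∈y) = qc≡1⇒nonempty io qy qcy≡o
            y′≡y = QSim⇒≡ qy′ qy u∈y′ z∈y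
                     (Sim-mono y′⊆s y⊆s sim , =E-trans qcy′≡o (=E-sym qcy≡o))
        in proj₂ (proj₁ (c-spec u) (y′⊆c u u∈y′))
                 (∈-respʳ-≡ u (Q⇒¬m qy′) (Q⇒¬m qy) y′≡y u∈y′)

  IsSingQ⇒Sim : ∀ {x s} → IsSingQ x s → Sim s s
  IsSingQ⇒Sim (_ , s-spec) z t z∈s t∈s = Q3 _ _ _ (≡x z∈s) (Q2 _ _ (≡x t∈s))
    where
      ≡x : ∀ {u} → u ∈ _ → u ≡ _
      ≡x u∈s with proj₁ (s-spec _) u∈s
      ... | inj₁ u≡x = u≡x
      ... | inj₂ u≡x = u≡x

theorem12 : ExcludedMiddle 0ℓ → (S : Structure) → IsQsharpModel S
    → ∀ x → Structure.m S x → ∀ s → Notions.IsSingQ S x s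
    → Notions._=E1 S (Structure.qc S s)
theorem12 em S ax x _ s singleton@(qs , s-spec) =
  qc-homogeneous≡1 qs (IsSingQ⇒Sim singleton) (proj₂ (s-spec x) (inj₁ (Q1 x)))
  where
    open QsharpModel em S ax
    open IsQsharpModel ax using (Q1)
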